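{- (Evaluation is well-defined.) For every $\mathbf{V}$-term $t$ with $\Gamma\vdash_{\mathbf{V}} t:A$: (1) $\Gamma\vdash_{\mathbf{IPC}}\mathrm{ev}(t):A$; (2) $\mathrm{ev}(t)$ is in normal form; (3) $t\to_{\mathbf{V}}^*\mathrm{ev}(t)$.
   Context: Formulas are built from propositional atoms and $\bot$ using $\to,\land,\lor$. Terms of $\mathbf{V}$: $t,s,u ::= x \mid t\,s \mid \lambda x.t \mid \mathtt{efq}(t) \mid \langle t,s\rangle \mid \pi_i t \mid \mathtt{in}_i t \mid \mathtt{case}\ t\ [y.s_1]\ [y.s_2] \mid \mathtt{V}_n(\vec x.t,\ y.s_1,\ y.s_2,\ z.\vec u)$ ($i\in\{1,2\}$, $n\ge1$), with $\vec x=x_1,\dots,x_n$ bound in $t$, $y$ in $s_1,s_2$, $z$ in each $u_1,\dots,u_n$; $t\{x:=s\}$ is capture-avoiding substitution; $\mathbf{IPC}$-terms are those without $\mathtt{V}_n$. Notation: $\lambda\vec x.t:=\lambda x_1.\cdots\lambda x_n.t$ and $(B_i\to C_i)_{i=1\dots n}\to E := (B_1\to C_1)\to(\cdots\to((B_n\to C_n)\to E))$. $\vdash_{\mathbf{IPC}}$: standard natural-deduction typing rules of intuitionistic propositional logic (axiom; $\lambda$ for $\to_I$; application for $\to_E$; pairs for $\land_I$; $\pi_i t:A_i$ from $t:A_1\land A_2$; $\mathtt{in}_i t:A_1\lor A_2$ from $t:A_i$; $\mathtt{case}\,t\,[y.s_1][y.s_2]:D$ from $t:A_1\lor A_2$ and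 $\Gamma,y:A_i\vdash s_i:D$; $\mathtt{efq}(t):A$ from $t:\bot$). $\vdash_{\mathbf{V}}$ adds Visser$_n$: from $x_1:B_1\to C_1,\dots,x_n:B_n\to C_n\vdash t:A_1\lor A_2$ (exactly these assumptions), $\Gamma,y:(B_i\to C_i)_{i}\to A_1\vdash s_1:D$, $\Gamma,y:(B_i\to C_i)_{i}\to A_2\vdash s_2:D$, and $\Gamma,z:(B_i\to C_i)_{i}\to B_j\vdash u_j:D$ for each $j$, infer $\Gamma\vdash \mathtt{V}_n(\vec x.t,y.s_1,y.s_2,z.\vec u):D$. Weak head contexts: $W::=\Box\mid W\,t\mid \pi_i W\mid \mathtt{case}\ W\ [y.s_1]\ [y.s_2]$. Top-level reductions: $(\lambda x.t)s\mapsto t\{x:=s\}$; $\pi_i\langle t_1,t_2\rangle\mapsto t_i$; $\mathtt{case}\,(\mathtt{in}_i t)\,[y.s_1][y.s_2]\mapsto s_i\{y:=t\}$ (these define $\to_{\mathbf{IPC}}$ after closure under all constructors); plus $\mathtt{V}_n(\vec x.\mathtt{in}_i t, y.s_1,y.s_2,z.\vec u)\mapsto s_i\{y:=\lambda\vec x.t\}$; $\mathtt{V}_n(\vec x.W\langle\mathtt{efq}(t)\rangle,\dots)\mapsto s_1\{y:=\lambda\vec x.\mathtt{efq}(t)\}$; $\mathtt{V}_n(\vec x.W\langle x_j\,t\rangle,\dots)\mapsto u_j\{z:=\lambda\vec x.t\}$ ($j=1..n$); $\to_{\mathbf{V}}$ is the closure of all of them under all term constructors. $\mathrm{nf}(\cdot)$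 denotes the function mapping each $\mathbf{IPC}$-typable term to its $\to_{\mathbf{IPC}}$-normal form. The evaluation $\mathrm{ev}(t)$ of a $\mathbf{V}$-typable term is defined by structural recursion: $\mathrm{ev}(x)=x$; $\mathrm{ev}(t\,s)=\mathrm{nf}(\mathrm{ev}(t)\,\mathrm{ev}(s))$; $\mathrm{ev}(\lambda x.t)=\lambda x.\mathrm{ev}(t)$; $\mathrm{ev}(\mathtt{efq}(t))=\mathtt{efq}(\mathrm{ev}(t))$; $\mathrm{ev}(\langle t,s\rangle)=\langle\mathrm{ev}(t),\mathrm{ev}(s)\rangle$; $\mathrm{ev}(\pi_i t)=\mathrm{nf}(\pi_i\,\mathrm{ev}(t))$; $\mathrm{ev}(\mathtt{in}_i t)=\mathrm{nf}(\mathtt{in}_i\,\mathrm{ev}(t))$; $\mathrm{ev}(\mathtt{case}\,t\,[y.s_1][y.s_2])=\mathrm{nf}(\mathtt{case}\,\mathrm{ev}(t)\,[y.\mathrm{ev}(s_1)][y.\mathrm{ev}(s_2)])$; and $\mathrm{ev}(\mathtt{V}_n(\vec x.t,y.s_1,y.s_2,z.\vec u))$ equals $\mathrm{nf}(\mathrm{ev}(s_i)\{y:=\lambda\vec x.t'\})$ if $\mathrm{ev}(t)=\mathtt{in}_i t'$, equals $\mathrm{nf}(\mathrm{ev}(s_1)\{y:=\lambda\vec x.\mathtt{efq}(t')\})$ if $\mathrm{ev}(t)=W\langle\mathtt{efq}(t')\rangle$, and equals $\mathrm{nf}(\mathrm{ev}(u_j)\{z:=\lambda\vec x.t'\})$ if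 $\mathrm{ev}(t)=W\langle x_j\,t'\rangle$. -}

module Defs where

open import Data.Nat using (ℕ; zero; suc; NonZero)
open import Data.Fin using (Fin; toℕ; opposite)
open import Data.Vec using (Vec; []; _∷_; lookup; _[_]≔_; toList; zipWith)
open import Data.List using (List; []; _∷_; reverse)
open import Data.Product using (_×_)
open import Relation.Nullary using (¬_)
open import Relation.Binary.Construct.Closure.ReflexiveTransitive using (Star)

data Form : Set where
  atom : ℕ → Form
  ⊥'   : Form
  _⇒_ _∧'_ _∨'_ : Form → Form → Form

infixr 5 _⇒_

data Side : Set where
  ₁ ₂ : Side

sideF : Side → Form → Form → Form
sideF ₁ A B = A
sideF ₂ A B = B

-- Raw terms, de Bruijn indices.
-- lam binds one variable; case t s₁ s₂ binds one variable (y) in s₁ and s₂;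
-- V k t s₁ s₂ us  is  V_k(x₁…x_k.t, y.s₁, y.s₂, z.us), k ≥ 1, with
-- x₁ (outermost) … x_k (innermost, de Bruijn index 0) bound in t,
-- y bound in s₁ s₂, z bound in each u_j.

data Tm : Set where
  var  : ℕ → Tm
  app  : Tm → Tm → Tm
  lam  : Tm → Tm
  efq  : Tm → Tm
  pair : Tm → Tm → Tm
  proj : Side → Tm → Tm
  inj  : Side → Tm → Tm
  case : Tm → Tm → Tm → Tm
  V    : (k : ℕ) → ⦃ NonZero k ⦄ → Tm → Tm → Tm → Vec Tm k → Tm

sel : Side → Tm → Tm → Tm
sel ₁ a b = a
sel ₂ a b = b

ext : (ℕ → ℕ) → ℕ → ℕ
ext ρ zero    = zero
ext ρ (suc i) = suc (ρ i)

extⁿ : ℕ → (ℕ → ℕ) → ℕ → ℕ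
extⁿ zero    ρ = ρ
extⁿ (suc n) ρ = ext (extⁿ n ρ)

mutual
  ren : (ℕ → ℕ) → Tm → Tm
  ren ρ (var i)      = var (ρ i)
  ren ρ (app t s)    = app (ren ρ t) (ren ρ s)
  ren ρ (lam t)      = lam (ren (ext ρ) t)
  ren ρ (efq t)      = efq (ren ρ t)
  ren ρ (pair t s)   = pair (ren ρ t) (ren ρ s)
  ren ρ (proj i t)   = proj i (ren ρ t)
  ren ρ (inj i t)    = inj i (ren ρ t)
  ren ρ (case t a b) = case (ren ρ t) (ren (ext ρ) a) (ren (ext ρ) b)
  ren ρ (V k ⦃ nz ⦄ t a b us) =
    V k ⦃ nz ⦄ (ren (extⁿ k ρ) t) (ren (ext ρ) a) (ren (ext ρ) b) (renVec (ext ρ) us)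

  renVec : ∀ {m} → (ℕ → ℕ) → Vec Tm m → Vec Tm m
  renVec ρ []       = []
  renVec ρ (u ∷ us) = ren ρ u ∷ renVec ρ us

exts : (ℕ → Tm) → ℕ → Tm
exts σ zero    = var zero
exts σ (suc i) = ren suc (σ i)

extsⁿ : ℕ → (ℕ → Tm) → ℕ → Tm
extsⁿ zero    σ = σ
extsⁿ (suc n) σ = exts (extsⁿ n σ)

mutual
  sub : (ℕ → Tm) → Tm → Tm
  sub σ (var i)      = σ i
  sub σ (app t s)    = app (sub σ t) (sub σ s)
  sub σ (lam t)      = lam (sub (exts σ) t)
  sub σ (efq t)      = efq (sub σ t)
  sub σ (pair t s)   = pair (sub σ t) (sub σ s)
  sub σ (proj i t)   = proj i (sub σ t)
  sub σ (inj i t)    = inj i (sub σ t)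
  sub σ (case t a b) = case (sub σ t) (sub (exts σ) a) (sub (exts σ) b)
  sub σ (V k ⦃ nz ⦄ t a b us) =
    V k ⦃ nz ⦄ (sub (extsⁿ k σ) t) (sub (exts σ) a) (sub (exts σ) b) (subVec (exts σ) us)

  subVec : ∀ {m} → (ℕ → Tm) → Vec Tm m → Vec Tm m
  subVec σ []       = []
  subVec σ (u ∷ us) = sub σ u ∷ subVec σ us

sub₀ : Tm → ℕ → Tm
sub₀ s zero    = s
sub₀ s (suc i) = var i

_[_]₀ : Tm → Tm → Tm
t [ s ]₀ = sub (sub₀ s) t

lamⁿ : ℕ → Tm → Tm
lamⁿ zero    t = t
lamⁿ (suc n) t = lam (lamⁿ n t)

-- the variable x_{j+1} inside the scope of x₁ … x_k (j : Fin k, 0-based)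
xvar : ∀ {k} → Fin k → Tm
xvar j = var (toℕ (opposite j))

data Sys : Set where
  IPC VS : Sys

data _∋_∶_ : List Form → ℕ → Form → Set where
  here  : ∀ {Γ A} → (A ∷ Γ) ∋ zero ∶ A
  there : ∀ {Γ A B i} → Γ ∋ i ∶ A → (B ∷ Γ) ∋ suc i ∶ A

arrows : ∀ {k} → Vec Form k → Vec Form k → Form → Form
arrows []       []       E = E
arrows (B ∷ Bs) (C ∷ Cs) E = (B ⇒ C) ⇒ arrows Bs Cs E

-- the context x₁ : B₁ → C₁, …, x_k : B_k → C_k  (x_k has de Bruijn index 0)
hyps : ∀ {k} → Vec Form k → Vec Form k → List Form
hyps Bs Cs = reverse (toList (zipWith _⇒_ Bs Cs))

data _⊢[_]_∶_ : List Form → Sys → Tm → Form → Set where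
  ax  : ∀ {Γ S i A} → Γ ∋ i ∶ A → Γ ⊢[ S ] var i ∶ A
  ⇒I  : ∀ {Γ S t A B} → (A ∷ Γ) ⊢[ S ] t ∶ B → Γ ⊢[ S ] lam t ∶ (A ⇒ B)
  ⇒E  : ∀ {Γ S t s A B} → Γ ⊢[ S ] t ∶ (A ⇒ B) → Γ ⊢[ S ] s ∶ A → Γ ⊢[ S ] app t s ∶ B
  ∧I  : ∀ {Γ S t s A B} → Γ ⊢[ S ] t ∶ A → Γ ⊢[ S ] s ∶ B → Γ ⊢[ S ] pair t s ∶ (A ∧' B)
  ∧E  : ∀ {Γ S t A B} (i : Side) → Γ ⊢[ S ] t ∶ (A ∧' B) → Γ ⊢[ S ] proj i t ∶ sideF i A B
  ∨I  : ∀ {Γ S t A B} (i : Side) → Γ ⊢[ S ] t ∶ sideF i A B → Γ ⊢[ S ] inj i t ∶ (A ∨' B)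
  ∨E  : ∀ {Γ S t s₁ s₂ A B D} → Γ ⊢[ S ] t ∶ (A ∨' B) →
        (A ∷ Γ) ⊢[ S ] s₁ ∶ D → (B ∷ Γ) ⊢[ S ] s₂ ∶ D → Γ ⊢[ S ] case t s₁ s₂ ∶ D
  ⊥E  : ∀ {Γ S t A} → Γ ⊢[ S ] t ∶ ⊥' → Γ ⊢[ S ] efq t ∶ A
  visser : ∀ {Γ k} ⦃ nz : NonZero k ⦄ {Bs Cs : Vec Form k} {A₁ A₂ D t s₁ s₂}
             {us : Vec Tm k} →
           hyps Bs Cs ⊢[ VS ] t ∶ (A₁ ∨' A₂) →
           (arrows Bs Cs A₁ ∷ Γ) ⊢[ VS ] s₁ ∶ D →
           (arrows Bs Cs A₂ ∷ Γ) ⊢[ VS ] s₂ ∶ D →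
           (∀ (j : Fin k) → (arrows Bs Cs (lookup Bs j) ∷ Γ) ⊢[ VS ] lookup us j ∶ D) →
           Γ ⊢[ VS ] V k t s₁ s₂ us ∶ D

data WCtx : Set where
  □     : WCtx
  appW  : WCtx → Tm → WCtx
  projW : Side → WCtx → WCtx
  caseW : WCtx → Tm → Tm → WCtx

plug : WCtx → Tm → Tm
plug □             h = h
plug (appW W t)    h = app (plug W h) t
plug (projW i W)   h = proj i (plug W h)
plug (caseW W a b) h = case (plug W h) a b

-- Reductions.  ↦[ IPC ] : the IPC top-level rules; ↦[ VS ] : all rules.

data _↦[_]_ : Tm → Sys → Tm → Set where
  β     : ∀ {S t s} → app (lam t) s ↦[ S ] (t [ s ]₀)
  πβ    : ∀ {S i t₁ t₂} → proj i (pair t₁ t₂) ↦[ S ] sel i t₁ t₂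
  caseβ : ∀ {S i t s₁ s₂} → case (inj i t) s₁ s₂ ↦[ S ] (sel i s₁ s₂ [ t ]₀)
  Vin   : ∀ {k} ⦃ nz : NonZero k ⦄ {i t s₁ s₂} {us : Vec Tm k} →
          V k (inj i t) s₁ s₂ us ↦[ VS ] (sel i s₁ s₂ [ lamⁿ k t ]₀)
  Vefq  : ∀ {k} ⦃ nz : NonZero k ⦄ {t s₁ s₂} {us : Vec Tm k} (W : WCtx) →
          V k (plug W (efq t)) s₁ s₂ us ↦[ VS ] (s₁ [ lamⁿ k (efq t) ]₀)
  Vx    : ∀ {k} ⦃ nz : NonZero k ⦄ {t s₁ s₂} {us : Vec Tm k} (W : WCtx) (j : Fin k) →
          V k (plug W (app (xvar j) t)) s₁ s₂ us ↦[ VS ] (lookup us j [ lamⁿ k t ]₀)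

data _⟶[_]_ : Tm → Sys → Tm → Set where
  top   : ∀ {S t t'} → t ↦[ S ] t' → t ⟶[ S ] t'
  appˡ  : ∀ {S t t' s} → t ⟶[ S ] t' → app t s ⟶[ S ] app t' s
  appʳ  : ∀ {S t s s'} → s ⟶[ S ] s' → app t s ⟶[ S ] app t s'
  lamξ  : ∀ {S t t'} → t ⟶[ S ] t' → lam t ⟶[ S ] lam t'
  efqξ  : ∀ {S t t'} → t ⟶[ S ] t' → efq t ⟶[ S ] efq t'
  pairˡ : ∀ {S t t' s} → t ⟶[ S ] t' → pair t s ⟶[ S ] pair t' s
  pairʳ : ∀ {S t s s'} → s ⟶[ S ] s' → pair t s ⟶[ S ] pair t s'
  projξ : ∀ {S i t t'} → t ⟶[ S ] t' → proj i t ⟶[ S ] proj i t'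
  injξ  : ∀ {S i t t'} → t ⟶[ S ] t' → inj i t ⟶[ S ] inj i t'
  caseξ₀ : ∀ {S t t' a b} → t ⟶[ S ] t' → case t a b ⟶[ S ] case t' a b
  caseξ₁ : ∀ {S t a a' b} → a ⟶[ S ] a' → case t a b ⟶[ S ] case t a' b
  caseξ₂ : ∀ {S t a b b'} → b ⟶[ S ] b' → case t a b ⟶[ S ] case t a b'
  Vξ₀   : ∀ {S k} ⦃ nz : NonZero k ⦄ {t t' a b} {us : Vec Tm k} →
          t ⟶[ S ] t' → V k t a b us ⟶[ S ] V k t' a b us
  Vξ₁   : ∀ {S k} ⦃ nz : NonZero k ⦄ {t a a' b} {us : Vec Tm k} →
          a ⟶[ S ] a' → V k t a b us ⟶[ S ] V k t a' b us
  Vξ₂   : ∀ {S k} ⦃ nz : NonZero k ⦄ {t a b b'} {us : Vec Tm k} →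
          b ⟶[ S ] b' → V k t a b us ⟶[ S ] V k t a b' us
  Vξᵤ   : ∀ {S k} ⦃ nz : NonZero k ⦄ {t a b u'} {us : Vec Tm k} (j : Fin k) →
          lookup us j ⟶[ S ] u' → V k t a b us ⟶[ S ] V k t a b (us [ j ]≔ u')

_⟶IPC_ : Tm → Tm → Set
t ⟶IPC t' = t ⟶[ IPC ] t'

_⟶V_ : Tm → Tm → Set
t ⟶V t' = t ⟶[ VS ] t'

_⟶IPC*_ : Tm → Tm → Set
_⟶IPC*_ = Star _⟶IPC_

_⟶V*_ : Tm → Tm → Set
_⟶V*_ = Star _⟶V_

Normal : Tm → Set
Normal t = ∀ {t'} → ¬ (t ⟶IPC t')

-- graph of nf: e = nf(u)
NF : Tm → Tm → Set
NF u e = (u ⟶IPC* e) × Normal e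

-- Evaluation, as the graph of ev:  Ev t e  means  ev(t) = e.

data Ev : Tm → Tm → Set where
  evVar  : ∀ {i} → Ev (var i) (var i)
  evApp  : ∀ {t s a b e} → Ev t a → Ev s b → NF (app a b) e → Ev (app t s) e
  evLam  : ∀ {t a} → Ev t a → Ev (lam t) (lam a)
  evEfq  : ∀ {t a} → Ev t a → Ev (efq t) (efq a)
  evPair : ∀ {t s a b} → Ev t a → Ev s b → Ev (pair t s) (pair a b)
  evProj : ∀ {i t a e} → Ev t a → NF (proj i a) e → Ev (proj i t) e
  evInj  : ∀ {i t a e} → Ev t a → NF (inj i a) e → Ev (inj i t) e
  evCase : ∀ {t s₁ s₂ a b₁ b₂ e} → Ev t a → Ev s₁ b₁ → Ev s₂ b₂ →
           NF (case a b₁ b₂) e → Ev (case t s₁ s₂) e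
  evVin  : ∀ {k} ⦃ nz : NonZero k ⦄ {t s₁ s₂} {us : Vec Tm k} {i t' b e} →
           Ev t (inj i t') → Ev (sel i s₁ s₂) b → NF (b [ lamⁿ k t' ]₀) e →
           Ev (V k t s₁ s₂ us) e
  evVefq : ∀ {k} ⦃ nz : NonZero k ⦄ {t s₁ s₂} {us : Vec Tm k} (W : WCtx) {t' b e} →
           Ev t (plug W (efq t')) → Ev s₁ b → NF (b [ lamⁿ k (efq t') ]₀) e →
           Ev (V k t s₁ s₂ us) e
  evVx   : ∀ {k} ⦃ nz : NonZero k ⦄ {t s₁ s₂} {us : Vec Tm k} (W : WCtx) (j : Fin k) {t' b e} →
           Ev t (plug W (app (xvar j) t')) → Ev (lookup us j) b → NF (b [ lamⁿ k t' ]₀) e →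
           Ev (V k t s₁ s₂ us) e

module Submission where

-- The proof is an induction on the V-typing derivation that follows the
-- recursive definition of ev.  It rests on two independent facts:
--  * weak normalisation of IPC (Tait-style reducibility, Kripke-closed under
--    renamings), which makes nf a total function on typable terms, together
--    with subject reduction, so that nf preserves types;
--  * the Visser progress lemma: an IPC-normal term of type A₁ ∨ A₂ in the
--    context x₁ : B₁ → C₁, …, xₙ : Bₙ → Cₙ is an injection  in_i m  or has, under
--    a weak head context, the head  efq(m)  or  x_j m;  so exactly one clause of
--    ev on V_n applies, and the corresponding V-reduction fires.

open import Defs
open import Data.Nat using (ℕ; zero; suc; NonZero)
open import Data.Fin using (Fin; toℕ; opposite)
open import Data.Fin.Properties using (toℕ-inject₁; toℕ-fromℕ)
open import Data.Vec using (Vec; []; _∷_; lookup; _[_]≔_; toList; zipWith)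
open import Data.Vec.Properties using (lookup-zipWith; length-toList; []≔-lookup; []≔-idempotent; lookup∘update)
open import Data.List using (List; []; _∷_; _++_; reverse; length; [_])
open import Data.List.Properties using (++-assoc; unfold-reverse; length-reverse)
open import Data.Product using (Σ; _×_; _,_; proj₁; proj₂)
open import Data.Sum using (_⊎_; inj₁; inj₂)
open import Relation.Binary.PropositionalEquality using (_≡_; refl; sym; trans; cong; cong₂; subst)
open import Relation.Binary.Construct.Closure.ReflexiveTransitive using (Star; ε; _◅_; _◅◅_; gmap)

-- The algebra of renaming and substitution
--
-- Each law is proved for pointwise-related renamings/substitutions, so that
-- it can be pushed under binders by the corresponding lifting lemma.

cong-case : ∀ {t t' a a' b b'} → t ≡ t' → a ≡ a' → b ≡ b' → case t a b ≡ case t' a' b'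
cong-case refl refl refl = refl

cong-V : ∀ {k} ⦃ nz : NonZero k ⦄ {t t' a a' b b'} {us us' : Vec Tm k} →
         t ≡ t' → a ≡ a' → b ≡ b' → us ≡ us' → V k t a b us ≡ V k t' a' b' us'
cong-V refl refl refl refl = refl

ext-ren-ren : ∀ {ρ₁ ρ₂ ρ₃} → (∀ i → ρ₁ (ρ₂ i) ≡ ρ₃ i) → ∀ i → ext ρ₁ (ext ρ₂ i) ≡ ext ρ₃ i
ext-ren-ren h zero    = refl
ext-ren-ren h (suc i) = cong suc (h i)

extⁿ-ren-ren : ∀ n {ρ₁ ρ₂ ρ₃} → (∀ i → ρ₁ (ρ₂ i) ≡ ρ₃ i) →
               ∀ i → extⁿ n ρ₁ (extⁿ n ρ₂ i) ≡ extⁿ n ρ₃ i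
extⁿ-ren-ren zero    h = h
extⁿ-ren-ren (suc n) h = ext-ren-ren (extⁿ-ren-ren n h)

mutual
  ren-ren : ∀ {ρ₁ ρ₂ ρ₃} → (∀ i → ρ₁ (ρ₂ i) ≡ ρ₃ i) → ∀ t → ren ρ₁ (ren ρ₂ t) ≡ ren ρ₃ t
  ren-ren h (var i)      = cong var (h i)
  ren-ren h (app t s)    = cong₂ app (ren-ren h t) (ren-ren h s)
  ren-ren h (lam t)      = cong lam (ren-ren (ext-ren-ren h) t)
  ren-ren h (efq t)      = cong efq (ren-ren h t)
  ren-ren h (pair t s)   = cong₂ pair (ren-ren h t) (ren-ren h s)
  ren-ren h (proj i t)   = cong (proj i) (ren-ren h t)
  ren-ren h (inj i t)    = cong (inj i) (ren-ren h t)
  ren-ren h (case t a b) =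
    cong-case (ren-ren h t) (ren-ren (ext-ren-ren h) a) (ren-ren (ext-ren-ren h) b)
  ren-ren h (V k t a b us) =
    cong-V (ren-ren (extⁿ-ren-ren k h) t) (ren-ren (ext-ren-ren h) a)
           (ren-ren (ext-ren-ren h) b) (renVec-renVec (ext-ren-ren h) us)

  renVec-renVec : ∀ {m ρ₁ ρ₂ ρ₃} → (∀ i → ρ₁ (ρ₂ i) ≡ ρ₃ i) →
                  (us : Vec Tm m) → renVec ρ₁ (renVec ρ₂ us) ≡ renVec ρ₃ us
  renVec-renVec h []       = refl
  renVec-renVec h (u ∷ us) = cong₂ _∷_ (ren-ren h u) (renVec-renVec h us)

ext-ren-sub : ∀ {ρ σ τ} → (∀ i → ren ρ (σ i) ≡ τ i) → ∀ i → ren (ext ρ) (exts σ i) ≡ exts τ i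
ext-ren-sub h zero = refl
ext-ren-sub {ρ} {σ} {τ} h (suc i) =
  trans (ren-ren (λ _ → refl) (σ i))
        (trans (sym (ren-ren (λ _ → refl) (σ i))) (cong (ren suc) (h i)))

extⁿ-ren-sub : ∀ n {ρ σ τ} → (∀ i → ren ρ (σ i) ≡ τ i) →
               ∀ i → ren (extⁿ n ρ) (extsⁿ n σ i) ≡ extsⁿ n τ i
extⁿ-ren-sub zero    h = h
extⁿ-ren-sub (suc n) h = ext-ren-sub (extⁿ-ren-sub n h)

mutual
  ren-sub : ∀ {ρ σ τ} → (∀ i → ren ρ (σ i) ≡ τ i) → ∀ t → ren ρ (sub σ t) ≡ sub τ t
  ren-sub h (var i)      = h i
  ren-sub h (app t s)    = cong₂ app (ren-sub h t) (ren-sub h s)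
  ren-sub h (lam t)      = cong lam (ren-sub (ext-ren-sub h) t)
  ren-sub h (efq t)      = cong efq (ren-sub h t)
  ren-sub h (pair t s)   = cong₂ pair (ren-sub h t) (ren-sub h s)
  ren-sub h (proj i t)   = cong (proj i) (ren-sub h t)
  ren-sub h (inj i t)    = cong (inj i) (ren-sub h t)
  ren-sub h (case t a b) =
    cong-case (ren-sub h t) (ren-sub (ext-ren-sub h) a) (ren-sub (ext-ren-sub h) b)
  ren-sub h (V k t a b us) =
    cong-V (ren-sub (extⁿ-ren-sub k h) t) (ren-sub (ext-ren-sub h) a)
           (ren-sub (ext-ren-sub h) b) (renVec-subVec (ext-ren-sub h) us)

  renVec-subVec : ∀ {m ρ σ τ} → (∀ i → ren ρ (σ i) ≡ τ i) →
                  (us : Vec Tm m) → renVec ρ (subVec σ us) ≡ subVec τ us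
  renVec-subVec h []       = refl
  renVec-subVec h (u ∷ us) = cong₂ _∷_ (ren-sub h u) (renVec-subVec h us)

ext-sub-ren : ∀ {σ ρ τ} → (∀ i → σ (ρ i) ≡ τ i) → ∀ i → exts σ (ext ρ i) ≡ exts τ i
ext-sub-ren h zero    = refl
ext-sub-ren h (suc i) = cong (ren suc) (h i)

extⁿ-sub-ren : ∀ n {σ ρ τ} → (∀ i → σ (ρ i) ≡ τ i) →
               ∀ i → extsⁿ n σ (extⁿ n ρ i) ≡ extsⁿ n τ i
extⁿ-sub-ren zero    h = h
extⁿ-sub-ren (suc n) h = ext-sub-ren (extⁿ-sub-ren n h)

mutual
  sub-ren : ∀ {σ ρ τ} → (∀ i → σ (ρ i) ≡ τ i) → ∀ t → sub σ (ren ρ t) ≡ sub τ t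
  sub-ren h (var i)      = h i
  sub-ren h (app t s)    = cong₂ app (sub-ren h t) (sub-ren h s)
  sub-ren h (lam t)      = cong lam (sub-ren (ext-sub-ren h) t)
  sub-ren h (efq t)      = cong efq (sub-ren h t)
  sub-ren h (pair t s)   = cong₂ pair (sub-ren h t) (sub-ren h s)
  sub-ren h (proj i t)   = cong (proj i) (sub-ren h t)
  sub-ren h (inj i t)    = cong (inj i) (sub-ren h t)
  sub-ren h (case t a b) =
    cong-case (sub-ren h t) (sub-ren (ext-sub-ren h) a) (sub-ren (ext-sub-ren h) b)
  sub-ren h (V k t a b us) =
    cong-V (sub-ren (extⁿ-sub-ren k h) t) (sub-ren (ext-sub-ren h) a)
           (sub-ren (ext-sub-ren h) b) (subVec-renVec (ext-sub-ren h) us)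

  subVec-renVec : ∀ {m σ ρ τ} → (∀ i → σ (ρ i) ≡ τ i) →
                  (us : Vec Tm m) → subVec σ (renVec ρ us) ≡ subVec τ us
  subVec-renVec h []       = refl
  subVec-renVec h (u ∷ us) = cong₂ _∷_ (sub-ren h u) (subVec-renVec h us)

ext-sub-id : ∀ {σ} → (∀ i → σ i ≡ var i) → ∀ i → exts σ i ≡ var i
ext-sub-id h zero    = refl
ext-sub-id h (suc i) = cong (ren suc) (h i)

extⁿ-sub-id : ∀ n {σ} → (∀ i → σ i ≡ var i) → ∀ i → extsⁿ n σ i ≡ var i
extⁿ-sub-id zero    h = h
extⁿ-sub-id (suc n) h = ext-sub-id (extⁿ-sub-id n h)

mutual
  sub-id : ∀ {σ} → (∀ i → σ i ≡ var i) → ∀ t → sub σ t ≡ t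
  sub-id h (var i)      = h i
  sub-id h (app t s)    = cong₂ app (sub-id h t) (sub-id h s)
  sub-id h (lam t)      = cong lam (sub-id (ext-sub-id h) t)
  sub-id h (efq t)      = cong efq (sub-id h t)
  sub-id h (pair t s)   = cong₂ pair (sub-id h t) (sub-id h s)
  sub-id h (proj i t)   = cong (proj i) (sub-id h t)
  sub-id h (inj i t)    = cong (inj i) (sub-id h t)
  sub-id h (case t a b) =
    cong-case (sub-id h t) (sub-id (ext-sub-id h) a) (sub-id (ext-sub-id h) b)
  sub-id h (V k t a b us) =
    cong-V (sub-id (extⁿ-sub-id k h) t) (sub-id (ext-sub-id h) a)
           (sub-id (ext-sub-id h) b) (subVec-id (ext-sub-id h) us)

  subVec-id : ∀ {m σ} → (∀ i → σ i ≡ var i) → (us : Vec Tm m) → subVec σ us ≡ us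
  subVec-id h []       = refl
  subVec-id h (u ∷ us) = cong₂ _∷_ (sub-id h u) (subVec-id h us)

ext-sub-sub : ∀ {σ τ υ} → (∀ i → sub σ (τ i) ≡ υ i) → ∀ i → sub (exts σ) (exts τ i) ≡ exts υ i
ext-sub-sub h zero = refl
ext-sub-sub {σ} {τ} {υ} h (suc i) =
  trans (sub-ren (λ _ → refl) (τ i))
        (trans (sym (ren-sub (λ _ → refl) (τ i))) (cong (ren suc) (h i)))

extⁿ-sub-sub : ∀ n {σ τ υ} → (∀ i → sub σ (τ i) ≡ υ i) →
               ∀ i → sub (extsⁿ n σ) (extsⁿ n τ i) ≡ extsⁿ n υ i
extⁿ-sub-sub zero    h = h
extⁿ-sub-sub (suc n) h = ext-sub-sub (extⁿ-sub-sub n h)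

mutual
  sub-sub : ∀ {σ τ υ} → (∀ i → sub σ (τ i) ≡ υ i) → ∀ t → sub σ (sub τ t) ≡ sub υ t
  sub-sub h (var i)      = h i
  sub-sub h (app t s)    = cong₂ app (sub-sub h t) (sub-sub h s)
  sub-sub h (lam t)      = cong lam (sub-sub (ext-sub-sub h) t)
  sub-sub h (efq t)      = cong efq (sub-sub h t)
  sub-sub h (pair t s)   = cong₂ pair (sub-sub h t) (sub-sub h s)
  sub-sub h (proj i t)   = cong (proj i) (sub-sub h t)
  sub-sub h (inj i t)    = cong (inj i) (sub-sub h t)
  sub-sub h (case t a b) =
    cong-case (sub-sub h t) (sub-sub (ext-sub-sub h) a) (sub-sub (ext-sub-sub h) b)
  sub-sub h (V k t a b us) =
    cong-V (sub-sub (extⁿ-sub-sub k h) t) (sub-sub (ext-sub-sub h) a)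
           (sub-sub (ext-sub-sub h) b) (subVec-subVec (ext-sub-sub h) us)

  subVec-subVec : ∀ {m σ τ υ} → (∀ i → sub σ (τ i) ≡ υ i) →
                  (us : Vec Tm m) → subVec σ (subVec τ us) ≡ subVec υ us
  subVec-subVec h []       = refl
  subVec-subVec h (u ∷ us) = cong₂ _∷_ (sub-sub h u) (subVec-subVec h us)

ren-id : ∀ t → ren (λ i → i) t ≡ t
ren-id t =
  trans (cong (ren (λ i → i)) (sym (sub-id (λ _ → refl) t)))
        (trans (ren-sub (λ _ → refl) t) (sub-id (λ _ → refl) t))

_•_ : Tm → (ℕ → Tm) → ℕ → Tm
(s • σ) zero    = s
(s • σ) (suc i) = σ i

ren-sub₀ : ∀ ρ t s → ren ρ (t [ s ]₀) ≡ (ren (ext ρ) t) [ ren ρ s ]₀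
ren-sub₀ ρ t s = trans (ren-sub {τ = ren ρ s • (λ i → var (ρ i))} ren-after t)
                       (sym (sub-ren sub-after t))
  where
  ren-after : ∀ i → ren ρ (sub₀ s i) ≡ (ren ρ s • (λ i → var (ρ i))) i
  ren-after zero    = refl
  ren-after (suc i) = refl
  sub-after : ∀ i → sub₀ (ren ρ s) (ext ρ i) ≡ (ren ρ s • (λ i → var (ρ i))) i
  sub-after zero    = refl
  sub-after (suc i) = refl

sub-exts-sub₀ : ∀ σ t s → (sub (exts σ) t) [ s ]₀ ≡ sub (s • σ) t
sub-exts-sub₀ σ t s = sub-sub pointwise t
  where
  pointwise : ∀ i → sub (sub₀ s) (exts σ i) ≡ (s • σ) i
  pointwise zero    = refl
  pointwise (suc i) = trans (sub-ren (λ _ → refl) (σ i)) (sub-id (λ _ → refl) (σ i))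

lam-sub : ∀ ρ σ t s → (ren (ext ρ) (sub (exts σ) t)) [ s ]₀ ≡ sub (s • (λ i → ren ρ (σ i))) t
lam-sub ρ σ t s =
  trans (cong (_[ s ]₀) (ren-sub (ext-ren-sub {ρ} {σ} (λ _ → refl)) t))
        (sub-exts-sub₀ (λ i → ren ρ (σ i)) t s)

ren-sel : ∀ ρ i a b → ren ρ (sel i a b) ≡ sel i (ren ρ a) (ren ρ b)
ren-sel ρ ₁ a b = refl
ren-sel ρ ₂ a b = refl

lookup-renVec : ∀ {m} ρ (us : Vec Tm m) j → lookup (renVec ρ us) j ≡ ren ρ (lookup us j)
lookup-renVec ρ (u ∷ us) Fin.zero    = refl
lookup-renVec ρ (u ∷ us) (Fin.suc j) = lookup-renVec ρ us j

renVec-update : ∀ {m} ρ (us : Vec Tm m) j u → renVec ρ (us [ j ]≔ u) ≡ renVec ρ us [ j ]≔ ren ρ u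
renVec-update ρ (x ∷ us) Fin.zero    u = refl
renVec-update ρ (x ∷ us) (Fin.suc j) u = cong (ren ρ x ∷_) (renVec-update ρ us j u)

-- Star (_⟶[ S ]_) is  →IPC*  for S = IPC and  →V*  for S = VS; the congruences
-- below are stated once for both systems.

Steps : Sys → Tm → Tm → Set
Steps S = Star (λ t t' → t ⟶[ S ] t')

module _ {S : Sys} where

  lam* : ∀ {t t'} → Steps S t t' → Steps S (lam t) (lam t')
  lam* = gmap lam lamξ

  efq* : ∀ {t t'} → Steps S t t' → Steps S (efq t) (efq t')
  efq* = gmap efq efqξ

  proj* : ∀ {i t t'} → Steps S t t' → Steps S (proj i t) (proj i t')
  proj* = gmap (proj _) projξ

  inj* : ∀ {i t t'} → Steps S t t' → Steps S (inj i t) (inj i t')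
  inj* = gmap (inj _) injξ

  app* : ∀ {t t' s s'} → Steps S t t' → Steps S s s' → Steps S (app t s) (app t' s')
  app* {t' = t'} {s = s} rs rs' = gmap (λ x → app x s) appˡ rs ◅◅ gmap (app t') appʳ rs'

  pair* : ∀ {t t' s s'} → Steps S t t' → Steps S s s' → Steps S (pair t s) (pair t' s')
  pair* {t' = t'} {s = s} rs rs' = gmap (λ x → pair x s) pairˡ rs ◅◅ gmap (pair t') pairʳ rs'

  case* : ∀ {t t' a a' b b'} → Steps S t t' → Steps S a a' → Steps S b b' →
          Steps S (case t a b) (case t' a' b')
  case* {t' = t'} {a} {a'} {b} rs rs₁ rs₂ =
    gmap (λ x → case x a b) caseξ₀ rs ◅◅ gmap (λ x → case t' x b) caseξ₁ rs₁
      ◅◅ gmap (case t' a') caseξ₂ rs₂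

  module _ {k} ⦃ nz : NonZero k ⦄ where

    V-scrutinee* : ∀ {t t' a b} {us : Vec Tm k} → Steps S t t' → Steps S (V k t a b us) (V k t' a b us)
    V-scrutinee* = gmap _ Vξ₀

    V-left* : ∀ {t a a' b} {us : Vec Tm k} → Steps S a a' → Steps S (V k t a b us) (V k t a' b us)
    V-left* = gmap _ Vξ₁

    V-right* : ∀ {t a b b'} {us : Vec Tm k} → Steps S b b' → Steps S (V k t a b us) (V k t a b' us)
    V-right* = gmap _ Vξ₂

    V-branch* : ∀ {t a b u'} (us : Vec Tm k) j → Steps S (lookup us j) u' →
                Steps S (V k t a b us) (V k t a b (us [ j ]≔ u'))
    V-branch* us j = go us refl
      where
      go : ∀ {t a b u u'} (vs : Vec Tm k) → u ≡ lookup vs j → Steps S u u' →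
           Steps S (V k t a b vs) (V k t a b (vs [ j ]≔ u'))
      go {t} {a} {b} vs refl ε =
        subst (λ ws → Steps S (V k t a b vs) (V k t a b ws)) (sym ([]≔-lookup vs j)) ε
      go {t} {a} {b} {u' = u'} vs refl (_◅_ {j = u₁} r rs) =
        Vξᵤ j r ◅ subst (λ ws → Steps S (V k t a b (vs [ j ]≔ u₁)) (V k t a b ws))
                        ([]≔-idempotent vs j)
                        (go (vs [ j ]≔ u₁) (sym (lookup∘update j vs u₁)) rs)

  embed : ∀ {t t'} → t ⟶IPC t' → t ⟶[ S ] t'
  embed (top β)     = top β
  embed (top πβ)    = top πβ
  embed (top caseβ) = top caseβ
  embed (appˡ r)    = appˡ (embed r)
  embed (appʳ r)    = appʳ (embed r)
  embed (lamξ r)    = lamξ (embed r)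
  embed (efqξ r)    = efqξ (embed r)
  embed (pairˡ r)   = pairˡ (embed r)
  embed (pairʳ r)   = pairʳ (embed r)
  embed (projξ r)   = projξ (embed r)
  embed (injξ r)    = injξ (embed r)
  embed (caseξ₀ r)  = caseξ₀ (embed r)
  embed (caseξ₁ r)  = caseξ₁ (embed r)
  embed (caseξ₂ r)  = caseξ₂ (embed r)
  embed (Vξ₀ r)     = Vξ₀ (embed r)
  embed (Vξ₁ r)     = Vξ₁ (embed r)
  embed (Vξ₂ r)     = Vξ₂ (embed r)
  embed (Vξᵤ j r)   = Vξᵤ j (embed r)

  embed* : ∀ {t t'} → t ⟶IPC* t' → Steps S t t'
  embed* = gmap (λ x → x) embed

ren-step : ∀ {t t'} ρ → t ⟶IPC t' → ren ρ t ⟶IPC ren ρ t'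
ren-step ρ (top (β {t = t} {s})) =
  subst (ren ρ (app (lam t) s) ⟶IPC_) (sym (ren-sub₀ ρ t s)) (top β)
ren-step ρ (top (πβ {i = i} {t₁} {t₂})) =
  subst (ren ρ (proj i (pair t₁ t₂)) ⟶IPC_) (sym (ren-sel ρ i t₁ t₂)) (top πβ)
ren-step ρ (top (caseβ {i = i} {t} {s₁} {s₂})) =
  subst (ren ρ (case (inj i t) s₁ s₂) ⟶IPC_)
    (sym (trans (ren-sub₀ ρ (sel i s₁ s₂) t) (cong (_[ ren ρ t ]₀) (ren-sel (ext ρ) i s₁ s₂))))
    (top caseβ)
ren-step ρ (appˡ r)   = appˡ (ren-step ρ r)
ren-step ρ (appʳ r)   = appʳ (ren-step ρ r)
ren-step ρ (lamξ r)   = lamξ (ren-step (ext ρ) r)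
ren-step ρ (efqξ r)   = efqξ (ren-step ρ r)
ren-step ρ (pairˡ r)  = pairˡ (ren-step ρ r)
ren-step ρ (pairʳ r)  = pairʳ (ren-step ρ r)
ren-step ρ (projξ r)  = projξ (ren-step ρ r)
ren-step ρ (injξ r)   = injξ (ren-step ρ r)
ren-step ρ (caseξ₀ r) = caseξ₀ (ren-step ρ r)
ren-step ρ (caseξ₁ r) = caseξ₁ (ren-step (ext ρ) r)
ren-step ρ (caseξ₂ r) = caseξ₂ (ren-step (ext ρ) r)
ren-step ρ (Vξ₀ {k = k} r) = Vξ₀ (ren-step (extⁿ k ρ) r)
ren-step ρ (Vξ₁ r)    = Vξ₁ (ren-step (ext ρ) r)
ren-step ρ (Vξ₂ r)    = Vξ₂ (ren-step (ext ρ) r)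
ren-step ρ (Vξᵤ {us = us} j r) =
  subst (λ vs → _ ⟶IPC V _ _ _ _ vs) (sym (renVec-update (ext ρ) us j _))
    (Vξᵤ j (subst (_⟶IPC _) (sym (lookup-renVec (ext ρ) us j)) (ren-step (ext ρ) r)))

ren-steps : ∀ {t t'} ρ → t ⟶IPC* t' → ren ρ t ⟶IPC* ren ρ t'
ren-steps ρ = gmap (ren ρ) (ren-step ρ)

mutual
  data Ne : Tm → Set where
    nvar  : ∀ {i} → Ne (var i)
    napp  : ∀ {n m} → Ne n → Nf m → Ne (app n m)
    nproj : ∀ {i n} → Ne n → Ne (proj i n)
    ncase : ∀ {n a b} → Ne n → Nf a → Nf b → Ne (case n a b)
    nefq  : ∀ {m} → Nf m → Ne (efq m)

  data Nf : Tm → Set where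
    nlam  : ∀ {t} → Nf t → Nf (lam t)
    npair : ∀ {t s} → Nf t → Nf s → Nf (pair t s)
    ninj  : ∀ {i t} → Nf t → Nf (inj i t)
    nne   : ∀ {t} → Ne t → Nf t

mutual
  ren-ne : ∀ {t} ρ → Ne t → Ne (ren ρ t)
  ren-ne ρ nvar          = nvar
  ren-ne ρ (napp n m)    = napp (ren-ne ρ n) (ren-nf ρ m)
  ren-ne ρ (nproj n)     = nproj (ren-ne ρ n)
  ren-ne ρ (ncase n a b) = ncase (ren-ne ρ n) (ren-nf (ext ρ) a) (ren-nf (ext ρ) b)
  ren-ne ρ (nefq m)      = nefq (ren-nf ρ m)

  ren-nf : ∀ {t} ρ → Nf t → Nf (ren ρ t)
  ren-nf ρ (nlam n)    = nlam (ren-nf (ext ρ) n)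
  ren-nf ρ (npair a b) = npair (ren-nf ρ a) (ren-nf ρ b)
  ren-nf ρ (ninj n)    = ninj (ren-nf ρ n)
  ren-nf ρ (nne n)     = nne (ren-ne ρ n)

mutual
  ne-normal : ∀ {t} → Ne t → Normal t
  ne-normal nvar          (top ())
  ne-normal (napp () m)   (top β)
  ne-normal (napp n m)    (appˡ r)   = ne-normal n r
  ne-normal (napp n m)    (appʳ r)   = nf-normal m r
  ne-normal (nproj ())    (top πβ)
  ne-normal (nproj n)     (projξ r)  = ne-normal n r
  ne-normal (ncase () a b) (top caseβ)
  ne-normal (ncase n a b) (caseξ₀ r) = ne-normal n r
  ne-normal (ncase n a b) (caseξ₁ r) = nf-normal a r
  ne-normal (ncase n a b) (caseξ₂ r) = nf-normal b r
  ne-normal (nefq m)      (efqξ r)   = nf-normal m r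

  nf-normal : ∀ {t} → Nf t → Normal t
  nf-normal (nlam n)    (lamξ r)  = nf-normal n r
  nf-normal (npair a b) (pairˡ r) = nf-normal a r
  nf-normal (npair a b) (pairʳ r) = nf-normal b r
  nf-normal (ninj n)    (injξ r)  = nf-normal n r
  nf-normal (nne n)     r         = ne-normal n r

Ren : List Form → List Form → (ℕ → ℕ) → Set
Ren Γ Δ ρ = ∀ {i A} → Γ ∋ i ∶ A → Δ ∋ ρ i ∶ A

Sub : List Form → List Form → (ℕ → Tm) → Set
Sub Γ Δ σ = ∀ {i A} → Γ ∋ i ∶ A → Δ ⊢[ IPC ] σ i ∶ A

ext-Ren : ∀ {Γ Δ ρ B} → Ren Γ Δ ρ → Ren (B ∷ Γ) (B ∷ Δ) (ext ρ)
ext-Ren h here      = here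
ext-Ren h (there x) = there (h x)

ren-ty : ∀ {Γ Δ ρ t A} → Ren Γ Δ ρ → Γ ⊢[ IPC ] t ∶ A → Δ ⊢[ IPC ] ren ρ t ∶ A
ren-ty h (ax x)       = ax (h x)
ren-ty h (⇒I d)       = ⇒I (ren-ty (ext-Ren h) d)
ren-ty h (⇒E d e)     = ⇒E (ren-ty h d) (ren-ty h e)
ren-ty h (∧I d e)     = ∧I (ren-ty h d) (ren-ty h e)
ren-ty h (∧E i d)     = ∧E i (ren-ty h d)
ren-ty h (∨I i d)     = ∨I i (ren-ty h d)
ren-ty h (∨E d d₁ d₂) = ∨E (ren-ty h d) (ren-ty (ext-Ren h) d₁) (ren-ty (ext-Ren h) d₂)
ren-ty h (⊥E d)       = ⊥E (ren-ty h d)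

exts-Sub : ∀ {Γ Δ σ B} → Sub Γ Δ σ → Sub (B ∷ Γ) (B ∷ Δ) (exts σ)
exts-Sub h here      = ax here
exts-Sub h (there x) = ren-ty there (h x)

sub-ty : ∀ {Γ Δ σ t A} → Sub Γ Δ σ → Γ ⊢[ IPC ] t ∶ A → Δ ⊢[ IPC ] sub σ t ∶ A
sub-ty h (ax x)       = h x
sub-ty h (⇒I d)       = ⇒I (sub-ty (exts-Sub h) d)
sub-ty h (⇒E d e)     = ⇒E (sub-ty h d) (sub-ty h e)
sub-ty h (∧I d e)     = ∧I (sub-ty h d) (sub-ty h e)
sub-ty h (∧E i d)     = ∧E i (sub-ty h d)
sub-ty h (∨I i d)     = ∨I i (sub-ty h d)
sub-ty h (∨E d d₁ d₂) = ∨E (sub-ty h d) (sub-ty (exts-Sub h) d₁) (sub-ty (exts-Sub h) d₂)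
sub-ty h (⊥E d)       = ⊥E (sub-ty h d)

sub₀-ty : ∀ {Γ B t s D} → (B ∷ Γ) ⊢[ IPC ] t ∶ D → Γ ⊢[ IPC ] s ∶ B → Γ ⊢[ IPC ] t [ s ]₀ ∶ D
sub₀-ty {Γ} {B} {s = s} d e = sub-ty single d
  where
  single : Sub (B ∷ Γ) Γ (sub₀ s)
  single here      = e
  single (there x) = ax x

sel-ty : ∀ {Γ i A B t₁ t₂} → Γ ⊢[ IPC ] t₁ ∶ A → Γ ⊢[ IPC ] t₂ ∶ B →
         Γ ⊢[ IPC ] sel i t₁ t₂ ∶ sideF i A B
sel-ty {i = ₁} d e = d
sel-ty {i = ₂} d e = e

subject-reduction : ∀ {Γ t t' A} → Γ ⊢[ IPC ] t ∶ A → t ⟶IPC t' → Γ ⊢[ IPC ] t' ∶ A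
subject-reduction (⇒E (⇒I d) e)        (top β)     = sub₀-ty d e
subject-reduction (∧E i (∧I d e))      (top πβ)    = sel-ty {i = i} d e
subject-reduction (∨E (∨I ₁ d) d₁ d₂)  (top caseβ) = sub₀-ty d₁ d
subject-reduction (∨E (∨I ₂ d) d₁ d₂)  (top caseβ) = sub₀-ty d₂ d
subject-reduction (⇒E d e)     (appˡ r)   = ⇒E (subject-reduction d r) e
subject-reduction (⇒E d e)     (appʳ r)   = ⇒E d (subject-reduction e r)
subject-reduction (⇒I d)       (lamξ r)   = ⇒I (subject-reduction d r)
subject-reduction (⊥E d)       (efqξ r)   = ⊥E (subject-reduction d r)
subject-reduction (∧I d e)     (pairˡ r)  = ∧I (subject-reduction d r) e
subject-reduction (∧I d e)     (pairʳ r)  = ∧I d (subject-reduction e r)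
subject-reduction (∧E i d)     (projξ r)  = ∧E i (subject-reduction d r)
subject-reduction (∨I i d)     (injξ r)   = ∨I i (subject-reduction d r)
subject-reduction (∨E d d₁ d₂) (caseξ₀ r) = ∨E (subject-reduction d r) d₁ d₂
subject-reduction (∨E d d₁ d₂) (caseξ₁ r) = ∨E d (subject-reduction d₁ r) d₂
subject-reduction (∨E d d₁ d₂) (caseξ₂ r) = ∨E d d₁ (subject-reduction d₂ r)

subject-reduction* : ∀ {Γ t t' A} → Γ ⊢[ IPC ] t ∶ A → t ⟶IPC* t' → Γ ⊢[ IPC ] t' ∶ A
subject-reduction* d ε        = d
subject-reduction* d (r ◅ rs) = subject-reduction* (subject-reduction d r) rs

-- Weakening by hypotheses appended at the outer end of the context; it lets
-- a term typed in the closed Visser context x⃗ be used under Γ.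
weaken∋ : ∀ {Δ Γ i A} → Δ ∋ i ∶ A → (Δ ++ Γ) ∋ i ∶ A
weaken∋ here      = here
weaken∋ (there x) = there (weaken∋ x)

weaken : ∀ {Δ Γ t A} → Δ ⊢[ IPC ] t ∶ A → (Δ ++ Γ) ⊢[ IPC ] t ∶ A
weaken (ax x)       = ax (weaken∋ x)
weaken (⇒I d)       = ⇒I (weaken d)
weaken (⇒E d e)     = ⇒E (weaken d) (weaken e)
weaken (∧I d e)     = ∧I (weaken d) (weaken e)
weaken (∧E i d)     = ∧E i (weaken d)
weaken (∨I i d)     = ∨I i (weaken d)
weaken (∨E d d₁ d₂) = ∨E (weaken d) (weaken d₁) (weaken d₂)
weaken (⊥E d)       = ⊥E (weaken d)

-- Weak normalisation of IPC
--
-- Reducibility candidates in the style of Tait.  Implications are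
-- Kripke-closed under arbitrary renamings, so that reducibility is stable
-- under going under binders; disjunctions are witnessed by reduction to an
-- injection of a reducible term or to a neutral term.

WN : Tm → Set
WN t = Σ Tm (λ n → t ⟶IPC* n × Nf n)

Reducible : Form → Tm → Set
Reducible (atom _) t = WN t
Reducible ⊥'       t = WN t
Reducible (A ⇒ B)  t = WN t × (∀ ρ s → Reducible A s → Reducible B (app (ren ρ t) s))
Reducible (A ∧' B) t = WN t × Reducible A (proj ₁ t) × Reducible B (proj ₂ t)
Reducible (A ∨' B) t = Σ Tm (λ r → t ⟶IPC* inj ₁ r × Reducible A r)
                     ⊎ Σ Tm (λ r → t ⟶IPC* inj ₂ r × Reducible B r)
                     ⊎ Σ Tm (λ n → t ⟶IPC* n × Ne n)

reducible⇒WN : ∀ A {t} → Reducible A t → WN t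
reducible⇒WN (atom _) r = r
reducible⇒WN ⊥'       r = r
reducible⇒WN (A ⇒ B)  r = proj₁ r
reducible⇒WN (A ∧' B) r = proj₁ r
reducible⇒WN (A ∨' B) (inj₁ (r , rs , ra)) with reducible⇒WN A ra
... | n , rs' , nf = inj ₁ n , rs ◅◅ inj* rs' , ninj nf
reducible⇒WN (A ∨' B) (inj₂ (inj₁ (r , rs , rb))) with reducible⇒WN B rb
... | n , rs' , nf = inj ₂ n , rs ◅◅ inj* rs' , ninj nf
reducible⇒WN (A ∨' B) (inj₂ (inj₂ (n , rs , ne))) = n , rs , nne ne

WN-backward : ∀ {t t'} → t ⟶IPC* t' → WN t' → WN t
WN-backward rs (n , rs' , nf) = n , rs ◅◅ rs' , nf

reducible-backward : ∀ A {t t'} → t ⟶IPC* t' → Reducible A t' → Reducible A t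
reducible-backward (atom _) rs r = WN-backward rs r
reducible-backward ⊥'       rs r = WN-backward rs r
reducible-backward (A ⇒ B)  rs (wn , f) =
  WN-backward rs wn , λ ρ s ra → reducible-backward B (app* (ren-steps ρ rs) ε) (f ρ s ra)
reducible-backward (A ∧' B) rs (wn , ra , rb) =
  WN-backward rs wn , reducible-backward A (proj* rs) ra , reducible-backward B (proj* rs) rb
reducible-backward (A ∨' B) rs (inj₁ (r , rs' , ra))         = inj₁ (r , rs ◅◅ rs' , ra)
reducible-backward (A ∨' B) rs (inj₂ (inj₁ (r , rs' , rb)))  = inj₂ (inj₁ (r , rs ◅◅ rs' , rb))
reducible-backward (A ∨' B) rs (inj₂ (inj₂ (n , rs' , ne))) = inj₂ (inj₂ (n , rs ◅◅ rs' , ne))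

neutral-reducible : ∀ A {t} → Ne t → Reducible A t
neutral-reducible (atom _) ne = _ , ε , nne ne
neutral-reducible ⊥'       ne = _ , ε , nne ne
neutral-reducible (A ⇒ B) {t} ne =
  (_ , ε , nne ne) , λ ρ s ra → applied ρ s (reducible⇒WN A ra)
  where
  applied : ∀ ρ s → WN s → Reducible B (app (ren ρ t) s)
  applied ρ s (n , rs , nf) =
    reducible-backward B (app* ε rs) (neutral-reducible B (napp (ren-ne ρ ne) nf))
neutral-reducible (A ∧' B) ne =
  (_ , ε , nne ne) , neutral-reducible A (nproj ne) , neutral-reducible B (nproj ne)
neutral-reducible (A ∨' B) ne = inj₂ (inj₂ (_ , ε , ne))

WN-ren : ∀ {t} ρ → WN t → WN (ren ρ t)
WN-ren ρ (n , rs , nf) = ren ρ n , ren-steps ρ rs , ren-nf ρ nf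

reducible-ren : ∀ A {t} ρ → Reducible A t → Reducible A (ren ρ t)
reducible-ren (atom _) ρ r = WN-ren ρ r
reducible-ren ⊥'       ρ r = WN-ren ρ r
reducible-ren (A ⇒ B) {t} ρ (wn , f) =
  WN-ren ρ wn ,
  λ ρ' s ra → subst (λ x → Reducible B (app x s)) (sym (ren-ren (λ _ → refl) t)) (f (λ i → ρ' (ρ i)) s ra)
reducible-ren (A ∧' B) ρ (wn , ra , rb) = WN-ren ρ wn , reducible-ren A ρ ra , reducible-ren B ρ rb
reducible-ren (A ∨' B) ρ (inj₁ (r , rs , ra)) =
  inj₁ (ren ρ r , ren-steps ρ rs , reducible-ren A ρ ra)
reducible-ren (A ∨' B) ρ (inj₂ (inj₁ (r , rs , rb))) =
  inj₂ (inj₁ (ren ρ r , ren-steps ρ rs , reducible-ren B ρ rb))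
reducible-ren (A ∨' B) ρ (inj₂ (inj₂ (n , rs , ne))) =
  inj₂ (inj₂ (ren ρ n , ren-steps ρ rs , ren-ne ρ ne))

ReducibleSub : List Form → (ℕ → Tm) → Set
ReducibleSub Γ σ = ∀ {i A} → Γ ∋ i ∶ A → Reducible A (σ i)

extend-reducible : ∀ {Γ σ A s} → ReducibleSub Γ σ → Reducible A s → ReducibleSub (A ∷ Γ) (s • σ)
extend-reducible h r here      = r
extend-reducible h r (there x) = h x

exts-reducible : ∀ {Γ σ A} → ReducibleSub Γ σ → ReducibleSub (A ∷ Γ) (exts σ)
exts-reducible {A = A} h here  = neutral-reducible A nvar
exts-reducible h (there {A = B} x) = reducible-ren B suc (h x)

ren-reducible : ∀ {Γ σ} ρ → ReducibleSub Γ σ → ReducibleSub Γ (λ i → ren ρ (σ i))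
ren-reducible ρ h {A = A} x = reducible-ren A ρ (h x)

fundamental : ∀ {Γ σ t A} → Γ ⊢[ IPC ] t ∶ A → ReducibleSub Γ σ → Reducible A (sub σ t)
fundamental (ax x) h = h x
fundamental {σ = σ} (⇒I {t = t} {A} {B} d) h with reducible⇒WN B (fundamental d (exts-reducible h))
... | n , rs , nf =
  (lam n , lam* rs , nlam nf) ,
  λ ρ s ra → reducible-backward B (top β ◅ ε)
    (subst (Reducible B) (sym (lam-sub ρ σ t s)) (fundamental d (extend-reducible (ren-reducible ρ h) ra)))
fundamental {σ = σ} (⇒E {t = t} {s} {A} {B} d e) h =
  subst (λ x → Reducible B (app x (sub σ s))) (ren-id (sub σ t))
    (proj₂ (fundamental d h) (λ i → i) (sub σ s) (fundamental e h))
fundamental (∧I {A = A} {B} d e) h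
  with reducible⇒WN A (fundamental d h) | reducible⇒WN B (fundamental e h)
... | n₁ , rs₁ , nf₁ | n₂ , rs₂ , nf₂ =
  (pair n₁ n₂ , pair* rs₁ rs₂ , npair nf₁ nf₂) ,
  reducible-backward A (top πβ ◅ ε) (fundamental d h) ,
  reducible-backward B (top πβ ◅ ε) (fundamental e h)
fundamental (∧E ₁ d) h = proj₁ (proj₂ (fundamental d h))
fundamental (∧E ₂ d) h = proj₂ (proj₂ (fundamental d h))
fundamental (∨I ₁ d) h = inj₁ (_ , ε , fundamental d h)
fundamental (∨I ₂ d) h = inj₂ (inj₁ (_ , ε , fundamental d h))
fundamental {σ = σ} (∨E {s₁ = s₁} {s₂} {D = D} d d₁ d₂) h with fundamental d h
... | inj₁ (r , rs , ra) =
  reducible-backward D (case* rs ε ε ◅◅ top caseβ ◅ ε)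
    (subst (Reducible D) (sym (sub-exts-sub₀ σ s₁ r)) (fundamental d₁ (extend-reducible h ra)))
... | inj₂ (inj₁ (r , rs , rb)) =
  reducible-backward D (case* rs ε ε ◅◅ top caseβ ◅ ε)
    (subst (Reducible D) (sym (sub-exts-sub₀ σ s₂ r)) (fundamental d₂ (extend-reducible h rb)))
... | inj₂ (inj₂ (n , rs , ne))
  with reducible⇒WN D (fundamental d₁ (exts-reducible h))
     | reducible⇒WN D (fundamental d₂ (exts-reducible h))
...   | n₁ , rs₁ , nf₁ | n₂ , rs₂ , nf₂ =
  reducible-backward D (case* rs rs₁ rs₂) (neutral-reducible D (ncase ne nf₁ nf₂))
fundamental (⊥E {A = A} d) h with fundamental d h
... | n , rs , nf = reducible-backward A (efq* rs) (neutral-reducible A (nefq nf))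

weakly-normalising : ∀ {Γ t A} → Γ ⊢[ IPC ] t ∶ A → WN t
weakly-normalising {t = t} {A} d =
  reducible⇒WN A (subst (Reducible A) (sub-id (λ _ → refl) t)
                        (fundamental d (λ {_} {B} _ → neutral-reducible B nvar)))

normalise : ∀ {Γ u A} → Γ ⊢[ IPC ] u ∶ A → Σ Tm (λ e → NF u e × (Γ ⊢[ IPC ] e ∶ A) × Nf e)
normalise d with weakly-normalising d
... | e , rs , nf = e , (rs , nf-normal nf) , subject-reduction* d rs , nf

hyps-unfold : ∀ {k} B C (Bs Cs : Vec Form k) Δ →
              hyps (B ∷ Bs) (C ∷ Cs) ++ Δ ≡ hyps Bs Cs ++ ((B ⇒ C) ∷ Δ)
hyps-unfold B C Bs Cs Δ =
  trans (cong (_++ Δ) (unfold-reverse (B ⇒ C) (toList (zipWith _⇒_ Bs Cs))))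
        (++-assoc (hyps Bs Cs) [ B ⇒ C ] Δ)

lamⁿ-ty : ∀ {k} (Bs Cs : Vec Form k) {Δ t A} → (hyps Bs Cs ++ Δ) ⊢[ IPC ] t ∶ A →
          Δ ⊢[ IPC ] lamⁿ k t ∶ arrows Bs Cs A
lamⁿ-ty []       []       d = d
lamⁿ-ty (B ∷ Bs) (C ∷ Cs) {Δ} d =
  ⇒I (lamⁿ-ty Bs Cs (subst (λ G → G ⊢[ IPC ] _ ∶ _) (hyps-unfold B C Bs Cs Δ) d))

-- The typing content of a V-reduction: substituting λx⃗.m for y, where
-- x⃗ ⊢ m : E, in a term typed under  y : (Bᵢ → Cᵢ)ᵢ → E.
instantiate : ∀ {Γ k} (Bs Cs : Vec Form k) {E D b m} →
              (arrows Bs Cs E ∷ Γ) ⊢[ IPC ] b ∶ D → hyps Bs Cs ⊢[ IPC ] m ∶ E →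
              Γ ⊢[ IPC ] b [ lamⁿ k m ]₀ ∶ D
instantiate {Γ} Bs Cs tyb tym = sub₀-ty tyb (lamⁿ-ty Bs Cs (weaken {Γ = Γ} tym))

∋-snoc : ∀ L {x i T} → (L ++ [ x ]) ∋ i ∶ T → (L ∋ i ∶ T) ⊎ (i ≡ length L × T ≡ x)
∋-snoc []      here      = inj₂ (refl , refl)
∋-snoc []      (there ())
∋-snoc (y ∷ L) here      = inj₁ here
∋-snoc (y ∷ L) (there p) with ∋-snoc L p
... | inj₁ q             = inj₁ (there q)
... | inj₂ (refl , T≡x)  = inj₂ (refl , T≡x)

∋-reverse : ∀ {k} (v : Vec Form k) {i T} → reverse (toList v) ∋ i ∶ T →
            Σ (Fin k) (λ j → i ≡ toℕ (opposite j) × T ≡ lookup v j)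
∋-reverse [] ()
∋-reverse {suc k} (x ∷ v) p
  with ∋-snoc (reverse (toList v)) (subst (λ G → G ∋ _ ∶ _) (unfold-reverse x (toList v)) p)
... | inj₁ q with ∋-reverse v q
...   | j , i≡ , T≡ = Fin.suc j , trans i≡ (sym (toℕ-inject₁ (opposite j))) , T≡
∋-reverse {suc k} (x ∷ v) p | inj₂ (i≡ , T≡) =
  Fin.zero ,
  trans i≡ (trans (trans (length-reverse (toList v)) (length-toList v)) (sym (toℕ-fromℕ k))) ,
  T≡

hyps-lookup : ∀ {k} {Bs Cs : Vec Form k} {i T} → hyps Bs Cs ∋ i ∶ T →
              Σ (Fin k) (λ j → i ≡ toℕ (opposite j) × T ≡ (lookup Bs j ⇒ lookup Cs j))
hyps-lookup {Bs = Bs} {Cs} p with ∋-reverse (zipWith _⇒_ Bs Cs) p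
... | j , i≡ , T≡ = j , i≡ , trans T≡ (lookup-zipWith _⇒_ j Bs Cs)

-- The Visser progress lemma

data IsArrow : Form → Set where
  arrow : ∀ {B C} → IsArrow (B ⇒ C)

Implicational : List Form → Set
Implicational Δ = ∀ {i A} → Δ ∋ i ∶ A → IsArrow A

hyps-implicational : ∀ {k} (Bs Cs : Vec Form k) → Implicational (hyps Bs Cs)
hyps-implicational Bs Cs x with hyps-lookup {Bs = Bs} {Cs} x
... | _ , _ , refl = arrow

data IsVar : Tm → Set where
  isVar : ∀ {i} → IsVar (var i)

data Head (Δ : List Form) : Tm → Set where
  efq-head : ∀ {m} → Δ ⊢[ IPC ] m ∶ ⊥' → Head Δ (efq m)
  hyp-head : ∀ {i B C m} → Δ ∋ i ∶ (B ⇒ C) → Δ ⊢[ IPC ] m ∶ B → Head Δ (app (var i) m)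

data Spine (Δ : List Form) : Tm → Set where
  spine : ∀ W {h} → Head Δ h → Spine Δ (plug W h)

-- In an implicational context a neutral term is a variable or a head under a
-- weak head context: projections and case-analyses cannot act on a variable.
neutral-spine : ∀ {Δ e A} → Implicational Δ → Ne e → Δ ⊢[ IPC ] e ∶ A → IsVar e ⊎ Spine Δ e
neutral-spine imp nvar     _      = inj₁ isVar
neutral-spine imp (nefq _) (⊥E d) = inj₂ (spine □ (efq-head d))
neutral-spine imp (napp n _) (⇒E d dm) with neutral-spine imp n d | d
... | inj₁ isVar       | ax x = inj₂ (spine □ (hyp-head x dm))
... | inj₂ (spine W h) | _    = inj₂ (spine (appW W _) h)
neutral-spine imp (nproj n) (∧E i d) with neutral-spine imp n d | d
... | inj₁ isVar       | ax x with imp x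
...   | ()
neutral-spine imp (nproj n) (∧E i d) | inj₂ (spine W h) | _ = inj₂ (spine (projW i W) h)
neutral-spine imp (ncase n _ _) (∨E d _ _) with neutral-spine imp n d | d
... | inj₁ isVar       | ax x with imp x
...   | ()
neutral-spine imp (ncase n _ _) (∨E d _ _) | inj₂ (spine W h) | _ = inj₂ (spine (caseW W _ _) h)

-- The three shapes on which ev(V_k(x⃗.t, …)) is defined, with the typing of the
-- subterm m that gets abstracted as λx⃗.m.
data VisserRedex {k} (Bs Cs : Vec Form k) (A₁ A₂ : Form) : Tm → Set where
  inj-redex : ∀ i {m} → hyps Bs Cs ⊢[ IPC ] m ∶ sideF i A₁ A₂ → VisserRedex Bs Cs A₁ A₂ (inj i m)
  efq-redex : ∀ W {m} → hyps Bs Cs ⊢[ IPC ] m ∶ ⊥' → VisserRedex Bs Cs A₁ A₂ (plug W (efq m))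
  hyp-redex : ∀ W j {m} → hyps Bs Cs ⊢[ IPC ] m ∶ lookup Bs j →
              VisserRedex Bs Cs A₁ A₂ (plug W (app (xvar j) m))

visser-progress : ∀ {k} {Bs Cs : Vec Form k} {A₁ A₂ e} →
                  Nf e → hyps Bs Cs ⊢[ IPC ] e ∶ (A₁ ∨' A₂) → VisserRedex Bs Cs A₁ A₂ e
visser-progress (ninj _) (∨I i d) = inj-redex i d
visser-progress {Bs = Bs} {Cs} (nne ne) d with neutral-spine (hyps-implicational Bs Cs) ne d | d
... | inj₁ isVar | ax x with hyps-implicational Bs Cs x
...   | ()
visser-progress (nne ne) d | inj₂ (spine W (efq-head dm)) | _ = efq-redex W dm
visser-progress {Bs = Bs} {Cs} (nne ne) d | inj₂ (spine W (hyp-head x dm)) | _ with hyps-lookup {Bs = Bs} {Cs} x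
... | j , refl , refl = hyp-redex W j dm

record Evaluation (Γ : List Form) (t : Tm) (A : Form) : Set where
  constructor evaluated
  field
    value   : Tm
    evals   : Ev t value
    typed   : Γ ⊢[ IPC ] value ∶ A
    normal  : Nf value
    reduces : t ⟶V* value

-- The common last step of every clause of ev that ends in nf(u): if t →V* u,
-- u is IPC-typable, and ev(t) = nf(u) holds by the clause in question, then t
-- evaluates.
evaluate-via-nf : ∀ {Γ t u A} → (∀ {e} → NF u e → Ev t e) → t ⟶V* u → Γ ⊢[ IPC ] u ∶ A →
                  Evaluation Γ t A
evaluate-via-nf clause rs d with normalise d
... | e , nfu@(rs' , _) , tye , nf = evaluated e (clause nfu) tye nf (rs ◅◅ embed* rs')

Vx-updated : ∀ {k} ⦃ nz : NonZero k ⦄ {s₁ s₂ m b} (us : Vec Tm k) W j →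
             V k (plug W (app (xvar j) m)) s₁ s₂ (us [ j ]≔ b) ⟶V (b [ lamⁿ k m ]₀)
Vx-updated {k} {s₁ = s₁} {s₂} {m} {b} us W j =
  subst (λ u → V k (plug W (app (xvar j) m)) s₁ s₂ (us [ j ]≔ b) ⟶V (u [ lamⁿ k m ]₀))
        (lookup∘update j us b) (top (Vx W j))

-- The V_k clause of ev, given the evaluations of all immediate subterms: the
-- progress lemma selects the clause, which then ends in nf as usual.
evaluate-V : ∀ {Γ k} ⦃ nz : NonZero k ⦄ {Bs Cs : Vec Form k} {A₁ A₂ D t s₁ s₂} {us : Vec Tm k} →
             Evaluation (hyps Bs Cs) t (A₁ ∨' A₂) →
             Evaluation (arrows Bs Cs A₁ ∷ Γ) s₁ D → Evaluation (arrows Bs Cs A₂ ∷ Γ) s₂ D →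
             (∀ j → Evaluation (arrows Bs Cs (lookup Bs j) ∷ Γ) (lookup us j) D) →
             Evaluation Γ (V k t s₁ s₂ us) D
evaluate-V {Bs = Bs} {Cs} {us = us}
  (evaluated _ evt tyt nft rst) (evaluated _ ev₁ ty₁ _ rs₁) (evaluated _ ev₂ ty₂ _ rs₂) Eᵤ
  with visser-progress {Bs = Bs} {Cs} nft tyt
... | inj-redex ₁ dm =
  evaluate-via-nf (evVin evt ev₁) (V-scrutinee* rst ◅◅ V-left* rs₁ ◅◅ top Vin ◅ ε)
                  (instantiate Bs Cs ty₁ dm)
... | inj-redex ₂ dm =
  evaluate-via-nf (evVin evt ev₂) (V-scrutinee* rst ◅◅ V-right* rs₂ ◅◅ top Vin ◅ ε)
                  (instantiate Bs Cs ty₂ dm)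
... | efq-redex W dm =
  evaluate-via-nf (evVefq W evt ev₁) (V-scrutinee* rst ◅◅ V-left* rs₁ ◅◅ top (Vefq W) ◅ ε)
                  (instantiate Bs Cs ty₁ (⊥E dm))
... | hyp-redex W j dm with Eᵤ j
...   | evaluated _ evb tyb _ rsb =
  evaluate-via-nf (evVx W j evt evb)
                  (V-scrutinee* rst ◅◅ V-branch* us j rsb ◅◅ Vx-updated us W j ◅ ε)
                  (instantiate Bs Cs tyb dm)

evaluate : ∀ {Γ t A} → Γ ⊢[ VS ] t ∶ A → Evaluation Γ t A
evaluate (ax x) = evaluated _ evVar (ax x) (nne nvar) ε
evaluate (⇒I d) with evaluate d
... | evaluated a eva tya nfa rsa = evaluated (lam a) (evLam eva) (⇒I tya) (nlam nfa) (lam* rsa)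
evaluate (⇒E d e) with evaluate d | evaluate e
... | evaluated _ eva tya _ rsa | evaluated _ evb tyb _ rsb =
  evaluate-via-nf (evApp eva evb) (app* rsa rsb) (⇒E tya tyb)
evaluate (∧I d e) with evaluate d | evaluate e
... | evaluated a eva tya nfa rsa | evaluated b evb tyb nfb rsb =
  evaluated (pair a b) (evPair eva evb) (∧I tya tyb) (npair nfa nfb) (pair* rsa rsb)
evaluate (∧E i d) with evaluate d
... | evaluated _ eva tya _ rsa = evaluate-via-nf (evProj eva) (proj* rsa) (∧E i tya)
evaluate (∨I i d) with evaluate d
... | evaluated _ eva tya _ rsa = evaluate-via-nf (evInj eva) (inj* rsa) (∨I i tya)
evaluate (∨E d d₁ d₂) with evaluate d | evaluate d₁ | evaluate d₂
... | evaluated _ eva tya _ rsa | evaluated _ ev₁ ty₁ _ rs₁ | evaluated _ ev₂ ty₂ _ rs₂ =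
  evaluate-via-nf (evCase eva ev₁ ev₂) (case* rsa rs₁ rs₂) (∨E tya ty₁ ty₂)
evaluate (⊥E d) with evaluate d
... | evaluated a eva tya nfa rsa = evaluated (efq a) (evEfq eva) (⊥E tya) (nne (nefq nfa)) (efq* rsa)
evaluate (visser d d₁ d₂ ds) =
  evaluate-V (evaluate d) (evaluate d₁) (evaluate d₂) (λ j → evaluate (ds j))

mainTheorem4 : (Γ : List Form) (t : Tm) (A : Form) → Γ ⊢[ VS ] t ∶ A →
    Σ Tm (λ e → Ev t e × (Γ ⊢[ IPC ] e ∶ A) × Normal e × (t ⟶V* e))
mainTheorem4 Γ t A d with evaluate d
... | evaluated e ev ty nf rs = e , ev , ty , nf-normal nf , rs
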